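{- Let $\sigma$ and $\tau$ be two exterior faces of a nondegenerate simplex $\alpha$ in the $d$-cube. Then $\sigma\cap\tau$ is an exterior face of $\alpha$ (possibly empty).
   Context: A nondegenerate $d$-simplex in the $d$-cube is the convex hull of $d+1$ affinely independent points of $\{0,1\}^d$. A $j$-face of the cube $[0,1]^d$ is obtained by fixing $d-j$ specified coordinates to specified values in $\{0,1\}$. A $j$-face of a simplex is the convex hull of $j+1$ of its vertices; it is exterior if it is contained in some $j$-face of the cube. The empty set is also regarded as an exterior face. -}

module Defs where

open import Data.Nat using (ℕ; zero; suc; _+_)
open import Data.Bool using (Bool; true; false)
open import Data.Maybe using (Maybe; just; nothing)
open import Data.Fin using (Fin; zero; suc)
open import Data.Fin.Subset using (Subset; _∈_; ∣_∣; ⊥)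
open import Data.Rational using (ℚ; 0ℚ; 1ℚ) renaming (_+_ to _+ℚ_; _*_ to _*ℚ_)
open import Data.Product using (Σ; _×_; _,_)
open import Data.Sum using (_⊎_)
open import Relation.Binary.PropositionalEquality using (_≡_)

CubeVertex : ℕ → Set
CubeVertex d = Fin d → Bool

b2q : Bool → ℚ
b2q true  = 1ℚ
b2q false = 0ℚ

sumℚ : (n : ℕ) → (Fin n → ℚ) → ℚ
sumℚ zero    f = 0ℚ
sumℚ (suc n) f = f zero +ℚ sumℚ n (λ i → f (suc i))

AffinelyIndependent : {m d : ℕ} → (Fin m → CubeVertex d) → Set
AffinelyIndependent {m} {d} v =
  (λ' : Fin m → ℚ) →
  sumℚ m λ' ≡ 0ℚ →
  ((k : Fin d) → sumℚ m (λ i → λ' i *ℚ b2q (v i k)) ≡ 0ℚ) →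
  (i : Fin m) → λ' i ≡ 0ℚ

Simplex : ℕ → Set
Simplex d = Σ (Fin (suc d) → CubeVertex d) AffinelyIndependent

-- A face of the cube [0,1]^d: each coordinate is either free (nothing)
-- or fixed to a value in {0,1} (just b).
CubeFace : ℕ → Set
CubeFace d = Fin d → Maybe Bool

dimCubeFace : {d : ℕ} → CubeFace d → ℕ
dimCubeFace {zero}  F = 0
dimCubeFace {suc d} F with F zero
... | nothing = suc (dimCubeFace (λ i → F (suc i)))
... | just _  = dimCubeFace (λ i → F (suc i))

InCubeFace : {d : ℕ} → CubeVertex d → CubeFace d → Set
InCubeFace {d} x F = (i : Fin d) (b : Bool) → F i ≡ just b → x i ≡ b

-- A face of the simplex α is given by its vertex set S ⊆ {0,…,d}
-- (a j-face has j+1 vertices; the empty face is S = ∅).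
-- It is exterior if it is empty, or if for j = |S| - 1 its convex hull is
-- contained in some j-face of the cube, i.e. (the cube face being convex)
-- all its vertices lie in that cube face.
Exterior : {d : ℕ} → Simplex d → Subset (suc d) → Set
Exterior {d} (v , _) S =
  (S ≡ ⊥) ⊎
  Σ (CubeFace d) (λ F →
     (suc (dimCubeFace F) ≡ ∣ S ∣) ×
     ((i : Fin (suc d)) → i ∈ S → InCubeFace (v i) F))

{-# OPTIONS --safe #-}
-- Suppose σ ∩ τ contains a vertex c, and let F, G be cube faces of dimensions
-- |σ| - 1 and |τ| - 1 containing σ and τ. As both contain c, they agree on the
-- coordinates both fix, so the face F ∧ G fixing what either fixes contains σ ∩ τ,
-- the face F ∨ G fixing what both fix contains σ ∪ τ, and
-- dim (F ∨ G) + dim (F ∧ G) = dim F + dim G. Affinely independent vertices of a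
-- k-face number at most k + 1: in homogeneous coordinates they are vectors
-- supported on k + 1 coordinates, so more of them are linearly dependent by
-- Gaussian elimination. Hence |σ ∪ τ| ≤ dim (F ∨ G) + 1 and
-- |σ ∩ τ| ≤ dim (F ∧ G) + 1, while |σ ∪ τ| + |σ ∩ τ| = |σ| + |τ| says the two
-- bounds add up to an equality. So both are equalities, and F ∧ G shows that
-- σ ∩ τ is exterior.
module Submission where

open import Defs
open import Data.Nat as ℕ using (ℕ; zero; suc; _<_; _≤_)
import Data.Nat.Properties as ℕ
open import Data.Bool using (Bool; _∧_; _∨_)
open import Data.Maybe as Maybe using (Maybe; just; nothing; is-nothing; _<∣>_)
open import Data.Fin using (Fin; zero; suc)
open import Data.Fin.Properties using (any?)
open import Data.Fin.Subset using (Subset; _∈_; _∉_; ∣_∣; Nonempty; _─_; ⁅_⁆; _∪_; _∩_; inside; outside)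
open import Data.Fin.Subset.Properties using (_∈?_; nonempty?; Empty-unique; ∉⊥; x∈p∩q⁻; x∈p∪q⁻; p─⊥≡p; p─q⊆p; drop-there; ∣p∣≤∣x∷p∣)
open import Data.Vec using (_∷_; []; here; there; tabulate)
open import Data.Vec.Properties using (lookup∘tabulate; lookup⇒[]=)
open import Data.Vec.Functional using (Vector)
open import Data.Rational using (ℚ; 0ℚ; 1ℚ; _+_; _*_; -_; _-_; 1/_; ≢-nonZero)
open import Data.Rational.Properties
  using (_≟_; +-*-commutativeRing; *-zeroˡ; *-zeroʳ; *-identityˡ; *-identityʳ; +-identityˡ; +-identityʳ; *-assoc; *-inverseˡ)
open import Algebra.Bundles using (CommutativeRing)
open import Algebra.Properties.Semiring.Sum (CommutativeRing.semiring +-*-commutativeRing)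
  using (sum; sum-syntax; sum-cong-≗; ∑-distrib-+; *-distribˡ-sum; *-distribʳ-sum)
open import Data.Rational.Solver using (module +-*-Solver)
open import Data.Product using (Σ; ∃; _×_; _,_; proj₁)
open import Data.Sum as Sum using (_⊎_; inj₁; inj₂; [_,_]′)
open import Function using (_∘_; const)
open import Relation.Nullary using (¬_; yes; no; contradiction)
open import Relation.Nullary.Decidable using (_×-dec_; ¬?; decidable-stable)
open import Relation.Binary.PropositionalEquality using (_≡_; _≢_; refl; sym; trans; cong; cong₂; subst; module ≡-Reasoning)

open +-*-Solver using (solve; con; _:+_; _:*_; _:-_; :-_; _:=_)

sumℚ≡sum : ∀ n (f : Vector ℚ n) → sumℚ n f ≡ sum f
sumℚ≡sum zero    f = refl
sumℚ≡sum (suc n) f = cong (f zero +_) (sumℚ≡sum n (f ∘ suc))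

δ : ∀ {n} → Fin n → ℚ → Vector ℚ n
δ zero    t zero    = t
δ zero    t (suc i) = 0ℚ
δ (suc p) t zero    = 0ℚ
δ (suc p) t (suc i) = δ p t i

δ-diag : ∀ {n} (p : Fin n) t → δ p t p ≡ t
δ-diag zero    t = refl
δ-diag (suc p) t = δ-diag p t

δ-offDiag : ∀ {n} (p : Fin n) t i → i ≢ p → δ p t i ≡ 0ℚ
δ-offDiag zero    t zero    i≢p = contradiction refl i≢p
δ-offDiag zero    t (suc i) i≢p = refl
δ-offDiag (suc p) t zero    i≢p = refl
δ-offDiag (suc p) t (suc i) i≢p = δ-offDiag p t i (i≢p ∘ cong suc)

∑-δ : ∀ {n} (p : Fin n) t (f : Vector ℚ n) → ∑[ i < n ] (δ p t i * f i) ≡ t * f p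
∑-δ {suc n} zero t f = begin
  t * f zero + ∑[ i < n ] (0ℚ * f (suc i)) ≡⟨ cong (t * f zero +_) (sym (*-distribˡ-sum {n} 0ℚ (f ∘ suc))) ⟩
  t * f zero + 0ℚ * sum {n} (f ∘ suc)      ≡⟨ cong (t * f zero +_) (*-zeroˡ (sum {n} (f ∘ suc))) ⟩
  t * f zero + 0ℚ                          ≡⟨ +-identityʳ (t * f zero) ⟩
  t * f zero                               ∎
  where open ≡-Reasoning
∑-δ {suc n} (suc p) t f = trans (cong₂ _+_ (*-zeroˡ (f zero)) (∑-δ p t (f ∘ suc))) (+-identityˡ _)

∑-linear : ∀ {n} c d (f g : Vector ℚ n) → ∑[ i < n ] (c * f i + d * g i) ≡ c * sum f + d * sum g
∑-linear {n} c d f g =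
  trans (∑-distrib-+ {n} _ _) (sym (cong₂ _+_ (*-distribˡ-sum {n} c f) (*-distribˡ-sum {n} d g)))

∑-supported-cong : ∀ {m} {S : Subset m} {μ f g : Vector ℚ m} → (∀ {i} → i ∉ S → μ i ≡ 0ℚ) →
                   (∀ {i} → i ∈ S → f i ≡ g i) → ∑[ i < m ] (μ i * f i) ≡ ∑[ i < m ] (μ i * g i)
∑-supported-cong {S = S} {μ} {f} {g} supp f≡g = sum-cong-≗ termwise
  where
  termwise : ∀ i → μ i * f i ≡ μ i * g i
  termwise i with i ∈? S
  ... | yes i∈S = cong (μ i *_) (f≡g i∈S)
  ... | no  i∉S rewrite supp i∉S = trans (*-zeroˡ (f i)) (sym (*-zeroˡ (g i)))

*-cancelˡ-≢0 : ∀ {a x} → a ≢ 0ℚ → a * x ≡ 0ℚ → x ≡ 0ℚ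
*-cancelˡ-≢0 {a} {x} a≢0 ax≡0 = begin
  x                ≡⟨ sym (*-identityˡ x) ⟩
  1ℚ * x           ≡⟨ cong (_* x) (sym (*-inverseˡ a)) ⟩
  (1/ a * a) * x   ≡⟨ *-assoc (1/ a) a x ⟩
  1/ a * (a * x)   ≡⟨ cong (1/ a *_) ax≡0 ⟩
  1/ a * 0ℚ        ≡⟨ *-zeroʳ (1/ a) ⟩
  0ℚ               ∎
  where
  open ≡-Reasoning
  instance _ = ≢-nonZero a≢0

x∉p─⁅x⁆ : ∀ {n} (x : Fin n) (p : Subset n) → x ∉ p ─ ⁅ x ⁆
x∉p─⁅x⁆ (suc x) (_ ∷ p) (there x∈p─⁅x⁆) = x∉p─⁅x⁆ x p x∈p─⁅x⁆

∣p∣≡1+∣p─⁅x⁆∣ : ∀ {n} {x : Fin n} {p : Subset n} → x ∈ p → ∣ p ∣ ≡ suc ∣ p ─ ⁅ x ⁆ ∣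
∣p∣≡1+∣p─⁅x⁆∣ {p = inside ∷ p}  here        = cong (suc ∘ ∣_∣) (sym (p─⊥≡p p))
∣p∣≡1+∣p─⁅x⁆∣ {p = inside ∷ p}  (there x∈p) = cong suc (∣p∣≡1+∣p─⁅x⁆∣ x∈p)
∣p∣≡1+∣p─⁅x⁆∣ {p = outside ∷ p} (there x∈p) = ∣p∣≡1+∣p─⁅x⁆∣ x∈p

0<∣p∣⇒nonempty : ∀ {n} (p : Subset n) → 0 < ∣ p ∣ → Nonempty p
0<∣p∣⇒nonempty (inside ∷ p)  _       = zero , here
0<∣p∣⇒nonempty (outside ∷ p) 0<∣p∣ with 0<∣p∣⇒nonempty p 0<∣p∣
... | x , x∈p = suc x , there x∈p

record LinearDependence {m n} (w : Fin m → Vector ℚ n) (S : Subset m) : Set where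
  field
    coeff      : Vector ℚ m
    supported  : ∀ {i} → i ∉ S → coeff i ≡ 0ℚ
    nontrivial : ∃ λ i → coeff i ≢ 0ℚ
    vanishes   : ∀ k → ∑[ i < m ] (coeff i * w i k) ≡ 0ℚ

dependence-in-ℚ⁰ : ∀ {m} (w : Fin m → Vector ℚ 0) {S} → Nonempty S → LinearDependence w S
dependence-in-ℚ⁰ w (p , p∈S) = record
  { coeff      = δ p 1ℚ
  ; supported  = λ {i} i∉S → δ-offDiag p 1ℚ i λ { refl → i∉S p∈S }
  ; nontrivial = p , λ δpp≡0 → contradiction (trans (sym (δ-diag p 1ℚ)) δpp≡0) λ ()
  ; vanishes   = λ ()
  }

dependence-tail⇒dependence : ∀ {m n} (w : Fin m → Vector ℚ (suc n)) {S} →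
                             (∀ {i} → i ∈ S → w i zero ≡ 0ℚ) →
                             LinearDependence (λ i → w i ∘ suc) S → LinearDependence w S
dependence-tail⇒dependence {m} w w₀≡0 ν = record
  { coeff      = coeff
  ; supported  = supported
  ; nontrivial = nontrivial
  ; vanishes   = λ { zero → vanishes₀ ; (suc k) → vanishes k }
  }
  where
  open LinearDependence ν
  vanishes₀ : ∑[ i < m ] (coeff i * w i zero) ≡ 0ℚ
  vanishes₀ = begin
    ∑[ i < m ] (coeff i * w i zero) ≡⟨ ∑-supported-cong supported w₀≡0 ⟩
    ∑[ i < m ] (coeff i * 0ℚ)       ≡⟨ sym (*-distribʳ-sum {m} 0ℚ coeff) ⟩
    sum coeff * 0ℚ                  ≡⟨ *-zeroʳ (sum coeff) ⟩
    0ℚ                              ∎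
    where open ≡-Reasoning

∑-scale+δ : ∀ {n} a (ν : Vector ℚ n) p t (f : Vector ℚ n) →
            ∑[ i < n ] ((a * ν i + δ p t i) * f i) ≡ a * ∑[ i < n ] (ν i * f i) + t * f p
∑-scale+δ {n} a ν p t f = begin
  ∑[ i < n ] ((a * ν i + δ p t i) * f i)
    ≡⟨ sum-cong-≗ (λ i → solve 4 (λ a ν d f → (a :* ν :+ d) :* f := a :* (ν :* f) :+ d :* f)
                                 refl a (ν i) (δ p t i) (f i)) ⟩
  ∑[ i < n ] (a * (ν i * f i) + δ p t i * f i)
    ≡⟨ ∑-distrib-+ {n} _ _ ⟩
  ∑[ i < n ] (a * (ν i * f i)) + ∑[ i < n ] (δ p t i * f i)
    ≡⟨ cong₂ _+_ (sym (*-distribˡ-sum {n} a (λ i → ν i * f i))) (∑-δ p t f) ⟩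
  a * ∑[ i < n ] (ν i * f i) + t * f p
    ∎
  where open ≡-Reasoning

-- Fraction-free Gaussian elimination of coordinate 0 with pivot vector p.
eliminate : ∀ {m n} → (Fin m → Vector ℚ (suc n)) → Fin m → Fin m → Vector ℚ n
eliminate w p i k = w p zero * w i (suc k) - w i zero * w p (suc k)

∑-eliminate : ∀ {m n} (w : Fin m → Vector ℚ (suc n)) p (ν : Vector ℚ m) k →
              ∑[ i < m ] (ν i * eliminate w p i k) ≡
              w p zero * ∑[ i < m ] (ν i * w i (suc k)) - ∑[ i < m ] (ν i * w i zero) * w p (suc k)
∑-eliminate {m} w p ν k = begin
  ∑[ i < m ] (ν i * eliminate w p i k)
    ≡⟨ sum-cong-≗ (λ i → solve 5 (λ ν a x y b → ν :* (a :* x :- y :* b) := a :* (ν :* x) :+ (:- b) :* (ν :* y))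
                                 refl (ν i) a (w i (suc k)) (w i zero) b) ⟩
  ∑[ i < m ] (a * (ν i * w i (suc k)) + (- b) * (ν i * w i zero))
    ≡⟨ ∑-linear a (- b) (λ i → ν i * w i (suc k)) (λ i → ν i * w i zero) ⟩
  a * ∑[ i < m ] (ν i * w i (suc k)) + (- b) * ∑[ i < m ] (ν i * w i zero)
    ≡⟨ solve 4 (λ a A b X → a :* A :+ (:- b) :* X := a :* A :- X :* b) refl a _ b _ ⟩
  a * ∑[ i < m ] (ν i * w i (suc k)) - ∑[ i < m ] (ν i * w i zero) * b
    ∎
  where
  open ≡-Reasoning
  a = w p zero
  b = w p (suc k)

dependence-eliminated⇒dependence : ∀ {m n} (w : Fin m → Vector ℚ (suc n)) {S p} → p ∈ S → w p zero ≢ 0ℚ →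
                                   LinearDependence (eliminate w p) (S ─ ⁅ p ⁆) → LinearDependence w S
dependence-eliminated⇒dependence {m} w {S} {p} p∈S a≢0 ν = record
  { coeff      = μ
  ; supported  = supported
  ; nontrivial = nontrivial
  ; vanishes   = λ { zero → vanishes₀ ; (suc k) → vanishesₛ k }
  }
  where
  module ν = LinearDependence ν
  a : ℚ
  a = w p zero
  X : ℚ
  X = ∑[ i < m ] (ν.coeff i * w i zero)
  μ : Vector ℚ m
  μ i = a * ν.coeff i + δ p (- X) i

  supported : ∀ {i} → i ∉ S → μ i ≡ 0ℚ
  supported {i} i∉S = begin
    a * ν.coeff i + δ p (- X) i ≡⟨ cong₂ (λ x y → a * x + y) (ν.supported (i∉S ∘ p─q⊆p S ⁅ p ⁆))
                                                              (δ-offDiag p (- X) i λ { refl → i∉S p∈S }) ⟩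
    a * 0ℚ + 0ℚ                 ≡⟨ trans (+-identityʳ (a * 0ℚ)) (*-zeroʳ a) ⟩
    0ℚ                          ∎
    where open ≡-Reasoning

  nontrivial : ∃ λ i → μ i ≢ 0ℚ
  nontrivial with ν.nontrivial
  ... | j , νⱼ≢0 = j , λ μⱼ≡0 → νⱼ≢0 (*-cancelˡ-≢0 a≢0 (begin
    a * ν.coeff j               ≡⟨ +-identityʳ (a * ν.coeff j) ⟨
    a * ν.coeff j + 0ℚ          ≡⟨ cong (a * ν.coeff j +_) δⱼ≡0 ⟨
    a * ν.coeff j + δ p (- X) j ≡⟨ μⱼ≡0 ⟩
    0ℚ                          ∎))
    where
    open ≡-Reasoning
    δⱼ≡0 : δ p (- X) j ≡ 0ℚ
    δⱼ≡0 = δ-offDiag p (- X) j λ { refl → νⱼ≢0 (ν.supported (x∉p─⁅x⁆ p S)) }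

  vanishes₀ : ∑[ i < m ] (μ i * w i zero) ≡ 0ℚ
  vanishes₀ = trans (∑-scale+δ a ν.coeff p (- X) (λ i → w i zero))
                    (solve 2 (λ a x → a :* x :+ (:- x) :* a := con 0ℚ) refl a X)

  vanishesₛ : ∀ k → ∑[ i < m ] (μ i * w i (suc k)) ≡ 0ℚ
  vanishesₛ k = begin
    ∑[ i < m ] (μ i * w i (suc k))             ≡⟨ ∑-scale+δ a ν.coeff p (- X) (λ i → w i (suc k)) ⟩
    a * A + (- X) * b                          ≡⟨ solve 4 (λ a A x b → a :* A :+ (:- x) :* b := a :* A :- x :* b) refl a A X b ⟩
    a * A - X * b                              ≡⟨ ∑-eliminate w p ν.coeff k ⟨
    ∑[ i < m ] (ν.coeff i * eliminate w p i k) ≡⟨ ν.vanishes k ⟩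
    0ℚ                                         ∎
    where
    open ≡-Reasoning
    A = ∑[ i < m ] (ν.coeff i * w i (suc k))
    b = w p (suc k)

∣support∣<∣S∣⇒dependence : ∀ {m} n (w : Fin m → Vector ℚ n) (C : Subset n) {S} →
                          (∀ i {k} → k ∉ C → w i k ≡ 0ℚ) → ∣ C ∣ < ∣ S ∣ → LinearDependence w S
∣support∣<∣S∣⇒dependence zero w [] {S} _ 0<∣S∣ = dependence-in-ℚ⁰ w (0<∣p∣⇒nonempty S 0<∣S∣)
∣support∣<∣S∣⇒dependence (suc n) w (c ∷ C) {S} w⊆C ∣c∷C∣<∣S∣
  with any? (λ p → p ∈? S ×-dec ¬? (w p zero ≟ 0ℚ))
... | no noPivot = dependence-tail⇒dependence w w₀≡0
      (∣support∣<∣S∣⇒dependence n (λ i → w i ∘ suc) C (λ i k∉C → w⊆C i (k∉C ∘ drop-there))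
                                 (ℕ.≤-<-trans (∣p∣≤∣x∷p∣ c C) ∣c∷C∣<∣S∣))
  where
  w₀≡0 : ∀ {i} → i ∈ S → w i zero ≡ 0ℚ
  w₀≡0 {i} i∈S = decidable-stable (w i zero ≟ 0ℚ) λ w₀≢0 → noPivot (i , i∈S , w₀≢0)
... | yes (p , p∈S , a≢0) with c
...   | outside = contradiction (w⊆C p λ ()) a≢0
...   | inside  = dependence-eliminated⇒dependence w p∈S a≢0
      (∣support∣<∣S∣⇒dependence n (eliminate w p) C eliminated⊆C
                                 (ℕ.≤-pred (subst (suc ∣ C ∣ <_) (∣p∣≡1+∣p─⁅x⁆∣ p∈S) ∣c∷C∣<∣S∣)))
  where
  eliminated⊆C : ∀ i {k} → k ∉ C → eliminate w p i k ≡ 0ℚ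
  eliminated⊆C i k∉C rewrite w⊆C i (k∉C ∘ drop-there) | w⊆C p (k∉C ∘ drop-there) =
    solve 2 (λ a x → a :* con 0ℚ :- x :* con 0ℚ := con 0ℚ) refl (w p zero) (w i zero)

freeSet : ∀ {d} → CubeFace d → Subset d
freeSet F = tabulate (is-nothing ∘ F)

∣freeSet∣≡dim : ∀ {d} (F : CubeFace d) → ∣ freeSet F ∣ ≡ dimCubeFace F
∣freeSet∣≡dim {zero}  F = refl
∣freeSet∣≡dim {suc d} F with F zero
... | nothing = cong suc (∣freeSet∣≡dim (F ∘ suc))
... | just _  = ∣freeSet∣≡dim (F ∘ suc)

freeCoordinate : Maybe Bool → Bool → ℚ
freeCoordinate nothing  x = b2q x
freeCoordinate (just _) x = 0ℚ

-- Homogeneous coordinates of x with those fixed by F zeroed out. On vertices of F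
-- they are supported on 1 + dim F coordinates, and a linear dependence among them
-- is an affine dependence, since a fixed coordinate is constant on F.
faceCoordinates : ∀ {d} → CubeFace d → CubeVertex d → Vector ℚ (suc d)
faceCoordinates F x zero    = 1ℚ
faceCoordinates F x (suc k) = freeCoordinate (F k) (x k)

faceCoordinates-support : ∀ {d} (F : CubeFace d) x {k} → k ∉ inside ∷ freeSet F → faceCoordinates F x k ≡ 0ℚ
faceCoordinates-support F x {zero}  0∉ = contradiction here 0∉
faceCoordinates-support F x {suc k} k∉ with F k in Fk≡
... | just _  = refl
... | nothing = contradiction (there (lookup⇒[]= k (freeSet F) (trans (lookup∘tabulate _ k) (cong is-nothing Fk≡)))) k∉

faceDependence⇒¬affinelyIndependent : ∀ {m d} {v : Fin m → CubeVertex d} {S F} →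
  (∀ i → i ∈ S → InCubeFace (v i) F) → LinearDependence (faceCoordinates F ∘ v) S → ¬ AffinelyIndependent v
faceDependence⇒¬affinelyIndependent {m} {v = v} {F = F} S⊆F μ indep with LinearDependence.nontrivial μ
... | j , μⱼ≢0 = μⱼ≢0 (indep coeff (trans (sumℚ≡sum m coeff) ∑μ≡0) (λ k → trans (sumℚ≡sum m _) (∑μv≡0 k)) j)
  where
  open LinearDependence μ
  ∑μ≡0 : sum coeff ≡ 0ℚ
  ∑μ≡0 = trans (sum-cong-≗ (λ i → sym (*-identityʳ (coeff i)))) (vanishes zero)
  ∑μv≡0 : ∀ k → ∑[ i < m ] (coeff i * b2q (v i k)) ≡ 0ℚ
  ∑μv≡0 k with F k in Fk≡
  ... | nothing = trans (sum-cong-≗ λ i → cong (λ z → coeff i * freeCoordinate z (v i k)) (sym Fk≡)) (vanishes (suc k))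
  ... | just b  = begin
    ∑[ i < m ] (coeff i * b2q (v i k)) ≡⟨ ∑-supported-cong supported (λ {i} i∈S → cong b2q (S⊆F i i∈S k b Fk≡)) ⟩
    ∑[ i < m ] (coeff i * b2q b)       ≡⟨ sym (*-distribʳ-sum {m} (b2q b) coeff) ⟩
    sum coeff * b2q b                  ≡⟨ cong (_* b2q b) ∑μ≡0 ⟩
    0ℚ * b2q b                         ≡⟨ *-zeroˡ (b2q b) ⟩
    0ℚ                                 ∎
    where open ≡-Reasoning

∣S∣≤1+dim : ∀ {m d} {v : Fin m → CubeVertex d} → AffinelyIndependent v → ∀ S F →
            (∀ i → i ∈ S → InCubeFace (v i) F) → ∣ S ∣ ≤ suc (dimCubeFace F)
∣S∣≤1+dim {d = d} {v} indep S F S⊆F = ℕ.≮⇒≥ λ 1+dim<∣S∣ →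
  faceDependence⇒¬affinelyIndependent S⊆F
    (∣support∣<∣S∣⇒dependence (suc d) (faceCoordinates F ∘ v) (inside ∷ freeSet F)
      (λ i → faceCoordinates-support F (v i))
      (subst (_< ∣ S ∣) (cong suc (sym (∣freeSet∣≡dim F))) 1+dim<∣S∣))
    indep

∣p∪q∣+∣p∩q∣≡∣p∣+∣q∣ : ∀ {n} (p q : Subset n) → ∣ p ∪ q ∣ ℕ.+ ∣ p ∩ q ∣ ≡ ∣ p ∣ ℕ.+ ∣ q ∣
∣p∪q∣+∣p∩q∣≡∣p∣+∣q∣ []            []            = refl
∣p∪q∣+∣p∩q∣≡∣p∣+∣q∣ (outside ∷ p) (outside ∷ q) = ∣p∪q∣+∣p∩q∣≡∣p∣+∣q∣ p q
∣p∪q∣+∣p∩q∣≡∣p∣+∣q∣ (inside ∷ p)  (outside ∷ q) = cong suc (∣p∪q∣+∣p∩q∣≡∣p∣+∣q∣ p q)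
∣p∪q∣+∣p∩q∣≡∣p∣+∣q∣ (outside ∷ p) (inside ∷ q)  =
  trans (cong suc (∣p∪q∣+∣p∩q∣≡∣p∣+∣q∣ p q)) (sym (ℕ.+-suc ∣ p ∣ ∣ q ∣))
∣p∪q∣+∣p∩q∣≡∣p∣+∣q∣ (inside ∷ p)  (inside ∷ q)  = cong suc (begin
  ∣ p ∪ q ∣ ℕ.+ suc ∣ p ∩ q ∣ ≡⟨ ℕ.+-suc ∣ p ∪ q ∣ ∣ p ∩ q ∣ ⟩
  suc (∣ p ∪ q ∣ ℕ.+ ∣ p ∩ q ∣) ≡⟨ cong suc (∣p∪q∣+∣p∩q∣≡∣p∣+∣q∣ p q) ⟩
  suc (∣ p ∣ ℕ.+ ∣ q ∣)         ≡⟨ ℕ.+-suc ∣ p ∣ ∣ q ∣ ⟨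
  ∣ p ∣ ℕ.+ suc ∣ q ∣           ∎)
  where open ≡-Reasoning

_∧ᶠ_ : ∀ {d} → CubeFace d → CubeFace d → CubeFace d
(F ∧ᶠ G) k = F k <∣> G k

-- Where F and G fix a coordinate to different values this keeps F's; faces
-- with a common vertex never do.
_∨ᶠ_ : ∀ {d} → CubeFace d → CubeFace d → CubeFace d
(F ∨ᶠ G) k = Maybe.zipWith const (F k) (G k)

freeSet-∧ᶠ : ∀ {d} (F G : CubeFace d) → freeSet (F ∧ᶠ G) ≡ freeSet F ∩ freeSet G
freeSet-∧ᶠ {zero}  F G = refl
freeSet-∧ᶠ {suc d} F G = cong₂ _∷_ (is-nothing-<∣> (F zero) (G zero)) (freeSet-∧ᶠ (F ∘ suc) (G ∘ suc))
  where
  is-nothing-<∣> : (x y : Maybe Bool) → is-nothing (x <∣> y) ≡ is-nothing x ∧ is-nothing y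
  is-nothing-<∣> (just _) y = refl
  is-nothing-<∣> nothing  y = refl

freeSet-∨ᶠ : ∀ {d} (F G : CubeFace d) → freeSet (F ∨ᶠ G) ≡ freeSet F ∪ freeSet G
freeSet-∨ᶠ {zero}  F G = refl
freeSet-∨ᶠ {suc d} F G = cong₂ _∷_ (is-nothing-zipWith (F zero) (G zero)) (freeSet-∨ᶠ (F ∘ suc) (G ∘ suc))
  where
  is-nothing-zipWith : (x y : Maybe Bool) → is-nothing (Maybe.zipWith const x y) ≡ is-nothing x ∨ is-nothing y
  is-nothing-zipWith (just _) (just _) = refl
  is-nothing-zipWith (just _) nothing  = refl
  is-nothing-zipWith nothing  y        = refl

dim-∨ᶠ+dim-∧ᶠ : ∀ {d} (F G : CubeFace d) →
                dimCubeFace (F ∨ᶠ G) ℕ.+ dimCubeFace (F ∧ᶠ G) ≡ dimCubeFace F ℕ.+ dimCubeFace G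
dim-∨ᶠ+dim-∧ᶠ F G = begin
  dimCubeFace (F ∨ᶠ G) ℕ.+ dimCubeFace (F ∧ᶠ G)   ≡⟨ cong₂ ℕ._+_ (∣freeSet∣≡dim (F ∨ᶠ G)) (∣freeSet∣≡dim (F ∧ᶠ G)) ⟨
  ∣ freeSet (F ∨ᶠ G) ∣ ℕ.+ ∣ freeSet (F ∧ᶠ G) ∣   ≡⟨ cong₂ (λ p q → ∣ p ∣ ℕ.+ ∣ q ∣) (freeSet-∨ᶠ F G) (freeSet-∧ᶠ F G) ⟩
  ∣ freeSet F ∪ freeSet G ∣ ℕ.+ ∣ freeSet F ∩ freeSet G ∣ ≡⟨ ∣p∪q∣+∣p∩q∣≡∣p∣+∣q∣ (freeSet F) (freeSet G) ⟩
  ∣ freeSet F ∣ ℕ.+ ∣ freeSet G ∣                 ≡⟨ cong₂ ℕ._+_ (∣freeSet∣≡dim F) (∣freeSet∣≡dim G) ⟩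
  dimCubeFace F ℕ.+ dimCubeFace G                 ∎
  where open ≡-Reasoning

inCubeFace-∧ᶠ : ∀ {d} {x : CubeVertex d} {F G} → InCubeFace x F → InCubeFace x G → InCubeFace x (F ∧ᶠ G)
inCubeFace-∧ᶠ {F = F} {G} x∈F x∈G k b Fk<∣>Gk≡b = [ x∈F k b , x∈G k b ]′ (<∣>-just (F k) Fk<∣>Gk≡b)
  where
  <∣>-just : ∀ x {y} {b : Bool} → x <∣> y ≡ just b → x ≡ just b ⊎ y ≡ just b
  <∣>-just (just _) refl = inj₁ refl
  <∣>-just nothing  eq   = inj₂ eq

inCubeFace-∨ᶠ : ∀ {d} {c x : CubeVertex d} {F G} → InCubeFace c F → InCubeFace c G →
                InCubeFace x F ⊎ InCubeFace x G → InCubeFace x (F ∨ᶠ G)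
inCubeFace-∨ᶠ {F = F} {G} c∈F c∈G x∈F⊎G k b F∨Gk≡b with F k in Fk≡ | G k in Gk≡ | F∨Gk≡b | x∈F⊎G
... | just _ | just b′ | refl | inj₁ x∈F = x∈F k b Fk≡
... | just _ | just b′ | refl | inj₂ x∈G = trans (x∈G k b′ Gk≡) (trans (sym (c∈G k b′ Gk≡)) (c∈F k b Fk≡))

m≤o∧n≤p∧m+n≡o+p⇒n≡p : ∀ {m n o p} → m ≤ o → n ≤ p → m ℕ.+ n ≡ o ℕ.+ p → n ≡ p
m≤o∧n≤p∧m+n≡o+p⇒n≡p {m} {n} {o} {p} m≤o n≤p m+n≡o+p =
  ℕ.≤-antisym n≤p (ℕ.+-cancelˡ-≤ o p n (subst (ℕ._≤ o ℕ.+ n) m+n≡o+p (ℕ.+-monoˡ-≤ n m≤o)))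

ExteriorWitness : ∀ {d} → (Fin (suc d) → CubeVertex d) → Subset (suc d) → Set
ExteriorWitness {d} v S =
  Σ (CubeFace d) λ F → (suc (dimCubeFace F) ≡ ∣ S ∣) × (∀ i → i ∈ S → InCubeFace (v i) F)

exteriorWitness : ∀ {d} (α : Simplex d) {S x} → x ∈ S → Exterior α S → ExteriorWitness (proj₁ α) S
exteriorWitness _ x∈S (inj₁ refl) = contradiction x∈S ∉⊥
exteriorWitness _ _   (inj₂ w)    = w

exteriorWitness-∩ : ∀ {d} {v : Fin (suc d) → CubeVertex d} {σ τ c} → AffinelyIndependent v →
                    c ∈ σ → c ∈ τ → ExteriorWitness v σ → ExteriorWitness v τ → ExteriorWitness v (σ ∩ τ)
exteriorWitness-∩ {v = v} {σ} {τ} {c} indep c∈σ c∈τ (F , 1+dimF≡∣σ∣ , σ⊆F) (G , 1+dimG≡∣τ∣ , τ⊆G) =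
  F ∧ᶠ G , sym (m≤o∧n≤p∧m+n≡o+p⇒n≡p (∣S∣≤1+dim indep (σ ∪ τ) (F ∨ᶠ G) σ∪τ⊆F∨G)
                                    (∣S∣≤1+dim indep (σ ∩ τ) (F ∧ᶠ G) σ∩τ⊆F∧G) sizes) , σ∩τ⊆F∧G
  where
  σ∩τ⊆F∧G : ∀ i → i ∈ σ ∩ τ → InCubeFace (v i) (F ∧ᶠ G)
  σ∩τ⊆F∧G i i∈σ∩τ with x∈p∩q⁻ σ τ i∈σ∩τ
  ... | i∈σ , i∈τ = inCubeFace-∧ᶠ (σ⊆F i i∈σ) (τ⊆G i i∈τ)
  σ∪τ⊆F∨G : ∀ i → i ∈ σ ∪ τ → InCubeFace (v i) (F ∨ᶠ G)
  σ∪τ⊆F∨G i i∈σ∪τ = inCubeFace-∨ᶠ (σ⊆F c c∈σ) (τ⊆G c c∈τ) (Sum.map (σ⊆F i) (τ⊆G i) (x∈p∪q⁻ σ τ i∈σ∪τ))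
  sizes : ∣ σ ∪ τ ∣ ℕ.+ ∣ σ ∩ τ ∣ ≡ suc (dimCubeFace (F ∨ᶠ G)) ℕ.+ suc (dimCubeFace (F ∧ᶠ G))
  sizes = begin
    ∣ σ ∪ τ ∣ ℕ.+ ∣ σ ∩ τ ∣                           ≡⟨ ∣p∪q∣+∣p∩q∣≡∣p∣+∣q∣ σ τ ⟩
    ∣ σ ∣ ℕ.+ ∣ τ ∣                                   ≡⟨ cong₂ ℕ._+_ 1+dimF≡∣σ∣ 1+dimG≡∣τ∣ ⟨
    suc (dimCubeFace F) ℕ.+ suc (dimCubeFace G)       ≡⟨ cong suc (ℕ.+-suc _ _) ⟩
    suc (suc (dimCubeFace F ℕ.+ dimCubeFace G))       ≡⟨ cong (λ n → suc (suc n)) (dim-∨ᶠ+dim-∧ᶠ F G) ⟨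
    suc (suc (dimCubeFace (F ∨ᶠ G) ℕ.+ dimCubeFace (F ∧ᶠ G))) ≡⟨ cong suc (ℕ.+-suc _ _) ⟨
    suc (dimCubeFace (F ∨ᶠ G)) ℕ.+ suc (dimCubeFace (F ∧ᶠ G)) ∎
    where open ≡-Reasoning

mainTheorem11 : (d : ℕ) (α : Simplex d) (σ τ : Subset (suc d)) →
    Exterior α σ → Exterior α τ → Exterior α (σ ∩ τ)
mainTheorem11 d α@(v , indep) σ τ σ-exterior τ-exterior with nonempty? (σ ∩ τ)
... | no  σ∩τ-empty   = inj₁ (Empty-unique σ∩τ-empty)
... | yes (c , c∈σ∩τ) with x∈p∩q⁻ σ τ c∈σ∩τ
...   | c∈σ , c∈τ = inj₂ (exteriorWitness-∩ indep c∈σ c∈τ (exteriorWitness α c∈σ σ-exterior)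
                                                             (exteriorWitness α c∈τ τ-exterior))
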